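{- Let $R$ be a finite group and let $M$ be a subgroup of $R$ with $|R:M|=2$ and $|M:Z(M)|=4$. Suppose $\gamma_2(M)=\langle a^2\rangle$ for some $a\in R\setminus M$ such that $o(a)=4$, $z^a=z^{ -1}$ for every $z\in Z(M)$, and $o(am)\ne 2$ for some $m\in M\setminus Z(M)$. Then there exists a non-identity automorphism $\varphi$ of $R$ with $g^\varphi\in\{g,g^{ -1}\}$ for every $g\in R\setminus M$.
   Context: $Z(M)$ denotes the center of $M$, $\gamma_2(M)$ its commutator subgroup, and $o(g)$ the order of an element $g$. -}

module Defs where

open import Level using (0ℓ)
open import Data.Nat using (ℕ; zero; suc; _<_; _*_)
open import Data.Fin using (Fin)
open import Data.Fin.Subset using (Subset; _∈_; ∣_∣)
open import Data.Product using (Σ; _×_; ∃)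
open import Data.Sum using (_⊎_)
open import Relation.Binary.PropositionalEquality using (_≡_; _≢_)
open import Relation.Nullary using (¬_)
open import Function.Bundles using (_⇔_)
open import Function.Definitions using (Injective; Surjective)
open import Algebra.Structures using (IsGroup)

-- A finite group of order n, represented on the carrier Fin n
-- (every finite group is isomorphic to one of this form).
record FinGroup : Set where
  field
    n       : ℕ
    _∙_     : Fin n → Fin n → Fin n
    e       : Fin n
    _⁻¹     : Fin n → Fin n
    isGroup : IsGroup _≡_ _∙_ e _⁻¹
  infixl 7 _∙_
  infix  8 _⁻¹

  Elt : Set
  Elt = Fin n

  _^_ : Elt → ℕ → Elt
  g ^ zero  = e
  g ^ suc k = g ∙ (g ^ k)

  conj : Elt → Elt → Elt
  conj x y = (y ⁻¹) ∙ x ∙ y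

  comm : Elt → Elt → Elt
  comm x y = (x ⁻¹) ∙ (y ⁻¹) ∙ x ∙ y

  HasOrder : Elt → ℕ → Set
  HasOrder g k = (0 < k) × (g ^ k ≡ e) × (∀ j → 0 < j → j < k → g ^ j ≢ e)

  Pred : Set₁
  Pred = Elt → Set

  HasSize : Pred → ℕ → Set
  HasSize P k = Σ (Subset n) λ S → (∀ x → (x ∈ S) ⇔ P x) × (∣ S ∣ ≡ k)

  record IsSubgroup (M : Pred) : Set where
    field
      has-e : M e
      has-∙ : ∀ {x y} → M x → M y → M (x ∙ y)
      has-⁻¹ : ∀ {x} → M x → M (x ⁻¹)

  data ⟨_⟩ (S : Pred) : Pred where
    gen : ∀ {x} → S x → ⟨ S ⟩ x
    unit : ⟨ S ⟩ e
    mul : ∀ {x y} → ⟨ S ⟩ x → ⟨ S ⟩ y → ⟨ S ⟩ (x ∙ y)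
    inv : ∀ {x} → ⟨ S ⟩ x → ⟨ S ⟩ (x ⁻¹)

  Centre : Pred → Pred
  Centre M z = M z × (∀ m → M m → z ∙ m ≡ m ∙ z)

  Commutators : Pred → Pred
  Commutators M x = ∃ λ u → ∃ λ v → M u × M v × (x ≡ comm u v)

  γ₂ : Pred → Pred
  γ₂ M = ⟨ Commutators M ⟩

  cyclic : Elt → Pred
  cyclic g = ⟨ (λ x → x ≡ g) ⟩

  _≐_ : Pred → Pred → Set
  P ≐ Q = ∀ x → P x ⇔ Q x

  HasIndex : Pred → ℕ → Set
  HasIndex M k = Σ ℕ λ m → HasSize M m × (n ≡ k * m)

  CentreIndex : Pred → ℕ → Set
  CentreIndex M k = Σ ℕ λ m → Σ ℕ λ z → HasSize M m × HasSize (Centre M) z × (m ≡ k * z)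

  record IsAutomorphism (φ : Elt → Elt) : Set where
    field
      hom : ∀ x y → φ (x ∙ y) ≡ φ x ∙ φ y
      injective : Injective _≡_ _≡_ φ
      surjective : Surjective _≡_ _≡_ φ

-- Put c = a². Every commutator of M lies in {e, c}, so c is central in R, M/Z(M) is a Klein
-- four-group, and for x, y ∈ M with [x, y] = c the coset of m ∈ M is determined by ([m, y], [m, x]).
-- Conjugation τ by a induces an involution of M/Z(M): either it fixes every coset or it swaps the
-- cosets of some such x and y. We take φ(g) = g θ(g) with θ a homomorphism into Ω₁(Z(R)) killing its
-- own image; φ is then an involutory automorphism, and it fixes or inverts g ∉ M as soon as θ(g) = e
-- or θ(g) = g⁻². Write μ g ∈ {g, a⁻¹g} for the M-part of g; a τ-invariant homomorphism F on M with
-- F(c) = e makes F ∘ μ a homomorphism on R. If τ fixes all cosets, F(m) := (a m)² for m ∉ Z(M) and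
-- F(Z(M)) = e is such an F (the squares (a r)² are central involutions depending only on the coset of
-- r), and θ = F ∘ μ is nontrivial because o(a m) ≠ 2 for some m ∉ Z(M). If τ swaps the cosets of x
-- and y, θ(g) = c^[g ∉ M] · [μ g, y] [μ g, x] works, and θ(a) = c ≠ e.

module Submission where

open import Defs
open import Level using (0ℓ)
open import Data.Empty using (⊥; ⊥-elim)
open import Data.Fin using (Fin; zero; suc; remQuot; combine) renaming (_≟_ to _≟ᶠ_)
open import Data.Fin.Properties using (injective⇒≤; combine-remQuot; suc-injective; nonZeroIndex)
open import Data.Fin.Subset using (Subset; _∈_; ∣_∣; inside; outside; ⊤)
open import Data.Fin.Subset.Properties using (_∈?_; ∈⊤; ∣⊤∣≡n)
open import Data.List using (List; []; _∷_; length; lookup)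
open import Data.List.Membership.Propositional.Properties using (∈-lookup)
open import Data.List.Relation.Unary.All as All using (All; []; _∷_)
open import Data.List.Relation.Unary.AllPairs using (AllPairs; []; _∷_)
import Data.List.Relation.Unary.AllPairs.Properties as AllPairs
open import Data.Nat using (suc; _≤_; _<_; _*_; z≤n; s≤s)
open import Data.Nat.Properties using (*-cancelʳ-≤)
open import Data.Product using (_×_; _,_; proj₁; proj₂; ∃; uncurry)
open import Data.Sum using (_⊎_; inj₁; inj₂)
import Data.Sum as Sum
open import Data.Unit using (tt) renaming (⊤ to Unit)
open import Data.Vec using (_∷_; here; there)
open import Function using (_∘_)
open import Function.Bundles using (Equivalence; mk⇔)
open import Relation.Binary.Definitions using (Symmetric)
open import Relation.Binary.PropositionalEquality
open import Relation.Nullary using (¬_; Dec; yes; no)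
open import Relation.Nullary.Decidable using (map′; decidable-stable)
open import Algebra.Bundles using (Group; Monoid)
open import Tactic.MonoidSolver using (solve)

enum : ∀ {n} (p : Subset n) → Fin ∣ p ∣ → Fin n
enum (inside  ∷ p) zero    = zero
enum (inside  ∷ p) (suc i) = suc (enum p i)
enum (outside ∷ p) i       = suc (enum p i)

index : ∀ {n} (p : Subset n) {x} → x ∈ p → Fin ∣ p ∣
index (inside  ∷ p) here      = zero
index (inside  ∷ p) (there q) = suc (index p q)
index (outside ∷ p) (there q) = index p q

enum-index : ∀ {n} (p : Subset n) {x} (q : x ∈ p) → enum p (index p q) ≡ x
enum-index (inside  ∷ p) here      = refl
enum-index (inside  ∷ p) (there q) = cong suc (enum-index p q)
enum-index (outside ∷ p) (there q) = cong suc (enum-index p q)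

enum-∈ : ∀ {n} (p : Subset n) (i : Fin ∣ p ∣) → enum p i ∈ p
enum-∈ (inside  ∷ p) zero    = here
enum-∈ (inside  ∷ p) (suc i) = there (enum-∈ p i)
enum-∈ (outside ∷ p) i       = there (enum-∈ p i)

enum-injective : ∀ {n} (p : Subset n) {i j} → enum p i ≡ enum p j → i ≡ j
enum-injective (inside  ∷ p) {zero}  {zero}  _  = refl
enum-injective (inside  ∷ p) {suc i} {suc j} eq = cong suc (enum-injective p (suc-injective eq))
enum-injective (outside ∷ p)                 eq = enum-injective p (suc-injective eq)

index-injective : ∀ {n} (p : Subset n) {x y} (q : x ∈ p) (r : y ∈ p) → index p q ≡ index p r → x ≡ y
index-injective p q r eq = trans (sym (enum-index p q)) (trans (cong (enum p) eq) (enum-index p r))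

allPairs-lookup : ∀ {A : Set} {_~_ : A → A → Set} → Symmetric _~_ → ∀ {xs} → AllPairs _~_ xs →
                  ∀ i j → i ≢ j → lookup xs i ~ lookup xs j
allPairs-lookup sym~ (_  ∷ _)   zero    zero    i≢j = ⊥-elim (i≢j refl)
allPairs-lookup sym~ (px ∷ _)   zero    (suc j) _   = All.lookup px (∈-lookup j)
allPairs-lookup sym~ (px ∷ _)   (suc i) zero    _   = sym~ (All.lookup px (∈-lookup i))
allPairs-lookup sym~ (_  ∷ pxs) (suc i) (suc j) i≢j = allPairs-lookup sym~ pxs i j (i≢j ∘ cong suc)

module _ (R : FinGroup) where
  open FinGroup R

  group : Group 0ℓ 0ℓ
  group = record { isGroup = isGroup }

  monoid : Monoid 0ℓ 0ℓ
  monoid = Group.monoid group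

  open Group group using (assoc; identityˡ; identityʳ; inverseˡ; inverseʳ)
  open import Algebra.Properties.Group group

  open ≡-Reasoning

  Commute : Elt → Elt → Set
  Commute g h = g ∙ h ≡ h ∙ g

  commute-e : ∀ g → Commute g e
  commute-e g = trans (identityʳ g) (sym (identityˡ g))

  commute-∙ : ∀ {g h k} → Commute g h → Commute g k → Commute g (h ∙ k)
  commute-∙ {g} {h} {k} gh gk = begin
    g ∙ (h ∙ k) ≡⟨ sym (assoc g h k) ⟩
    g ∙ h ∙ k   ≡⟨ cong (_∙ k) gh ⟩
    h ∙ g ∙ k   ≡⟨ assoc h g k ⟩
    h ∙ (g ∙ k) ≡⟨ cong (h ∙_) gk ⟩
    h ∙ (k ∙ g) ≡⟨ sym (assoc h k g) ⟩
    h ∙ k ∙ g   ∎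

  commute-⁻¹ : ∀ {g h} → Commute g h → Commute g (h ⁻¹)
  commute-⁻¹ {g} {h} gh = ∙-cancelˡ h _ _ (begin
    h ∙ (g ∙ h ⁻¹)   ≡⟨ sym (assoc h g _) ⟩
    h ∙ g ∙ h ⁻¹     ≡⟨ cong (_∙ h ⁻¹) (sym gh) ⟩
    g ∙ h ∙ h ⁻¹     ≡⟨ //-rightDividesʳ h g ⟩
    g                ≡⟨ sym (\\-leftDividesˡ h g) ⟩
    h ∙ (h ⁻¹ ∙ g)   ∎)

  interchange : ∀ w x y z → Commute x y → (w ∙ x) ∙ (y ∙ z) ≡ (w ∙ y) ∙ (x ∙ z)
  interchange w x y z xy = begin
    (w ∙ x) ∙ (y ∙ z) ≡⟨ solve monoid ⟩
    w ∙ (x ∙ y) ∙ z   ≡⟨ cong (λ u → w ∙ u ∙ z) xy ⟩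
    w ∙ (y ∙ x) ∙ z   ≡⟨ solve monoid ⟩
    (w ∙ y) ∙ (x ∙ z) ∎

  conj-∙ : ∀ x z y → conj (x ∙ z) y ≡ conj x y ∙ conj z y
  conj-∙ x z y = begin
    y ⁻¹ ∙ (x ∙ z) ∙ y                 ≡⟨ cong (λ u → y ⁻¹ ∙ (x ∙ u) ∙ y) (sym (\\-leftDividesˡ y z)) ⟩
    y ⁻¹ ∙ (x ∙ (y ∙ (y ⁻¹ ∙ z))) ∙ y ≡⟨ solve monoid ⟩
    (y ⁻¹ ∙ x ∙ y) ∙ (y ⁻¹ ∙ z ∙ y)   ∎

  conj-e : ∀ y → conj e y ≡ e
  conj-e y = trans (cong (_∙ y) (identityʳ (y ⁻¹))) (inverseˡ y)

  conj-⁻¹ : ∀ x y → conj (x ⁻¹) y ≡ conj x y ⁻¹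
  conj-⁻¹ x y = inverseʳ-unique (conj x y) _
    (trans (sym (conj-∙ x (x ⁻¹) y)) (trans (cong (λ u → conj u y) (inverseʳ x)) (conj-e y)))

  ∙-conj : ∀ x y → y ∙ conj x y ≡ x ∙ y
  ∙-conj x y = begin
    y ∙ (y ⁻¹ ∙ x ∙ y)    ≡⟨ solve monoid ⟩
    y ∙ (y ⁻¹ ∙ (x ∙ y))  ≡⟨ \\-leftDividesˡ y (x ∙ y) ⟩
    x ∙ y                 ∎

  conj-commuting : ∀ {x y} → Commute x y → conj x y ≡ x
  conj-commuting {x} {y} xy = trans (assoc _ _ _) (trans (cong (y ⁻¹ ∙_) xy) (\\-leftDividesʳ y x))

  conj-conj : ∀ x g h → conj (conj x g) h ≡ conj x (g ∙ h)
  conj-conj x g h = begin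
    h ⁻¹ ∙ (g ⁻¹ ∙ x ∙ g) ∙ h     ≡⟨ solve monoid ⟩
    (h ⁻¹ ∙ g ⁻¹) ∙ x ∙ (g ∙ h)   ≡⟨ cong (λ u → u ∙ x ∙ (g ∙ h)) (sym (⁻¹-anti-homo-∙ g h)) ⟩
    (g ∙ h) ⁻¹ ∙ x ∙ (g ∙ h)      ∎

  conj≡e⇒≡e : ∀ {x y} → conj x y ≡ e → x ≡ e
  conj≡e⇒≡e {x} {y} eq = ∙-cancelʳ y x e
    (trans (sym (∙-conj x y)) (trans (cong (y ∙_) eq) (commute-e y)))

  conj≡∙comm : ∀ u x → conj u x ≡ u ∙ comm u x
  conj≡∙comm u x = sym (begin
    u ∙ (u ⁻¹ ∙ x ⁻¹ ∙ u ∙ x)     ≡⟨ solve monoid ⟩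
    u ∙ (u ⁻¹ ∙ (x ⁻¹ ∙ u ∙ x))   ≡⟨ \\-leftDividesˡ u (x ⁻¹ ∙ u ∙ x) ⟩
    x ⁻¹ ∙ u ∙ x                  ∎)

  square≡e⇒order2 : ∀ {g} → g ≢ e → g ∙ g ≡ e → HasOrder g 2
  square≡e⇒order2 {g} g≢e g²≡e = s≤s z≤n , trans (cong (g ∙_) (identityʳ g)) g²≡e , lower-powers
    where
    lower-powers : ∀ j → 0 < j → j < 2 → g ^ j ≢ e
    lower-powers 1 _ _ g¹≡e = g≢e (trans (sym (identityʳ g)) g¹≡e)
    lower-powers (suc (suc _)) _ (s≤s (s≤s ()))

  square-∙ : ∀ g h → (g ∙ h) ∙ (g ∙ h) ≡ (g ∙ g) ∙ conj h g ∙ h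
  square-∙ g h = begin
    (g ∙ h) ∙ (g ∙ h)                   ≡⟨ cong (λ u → (g ∙ u) ∙ (g ∙ h)) (sym (\\-leftDividesˡ g h)) ⟩
    (g ∙ (g ∙ (g ⁻¹ ∙ h))) ∙ (g ∙ h)    ≡⟨ solve monoid ⟩
    (g ∙ g) ∙ (g ⁻¹ ∙ h ∙ g) ∙ h        ∎

  comm-conj : ∀ u v y → conj (comm u v) y ≡ comm (conj u y) (conj v y)
  comm-conj u v y = begin
    conj (u ⁻¹ ∙ v ⁻¹ ∙ u ∙ v) y                          ≡⟨ conj-∙ _ v y ⟩
    conj (u ⁻¹ ∙ v ⁻¹ ∙ u) y ∙ conj v y                   ≡⟨ cong (_∙ conj v y) (conj-∙ _ u y) ⟩
    conj (u ⁻¹ ∙ v ⁻¹) y ∙ conj u y ∙ conj v y            ≡⟨ cong (λ w → w ∙ conj u y ∙ conj v y) (conj-∙ _ _ y) ⟩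
    conj (u ⁻¹) y ∙ conj (v ⁻¹) y ∙ conj u y ∙ conj v y  ≡⟨ cong₂ (λ p q → p ∙ q ∙ conj u y ∙ conj v y) (conj-⁻¹ u y) (conj-⁻¹ v y) ⟩
    comm (conj u y) (conj v y)                            ∎

  ∙-comm : ∀ u v → v ∙ u ∙ comm u v ≡ u ∙ v
  ∙-comm u v = begin
    v ∙ u ∙ (u ⁻¹ ∙ v ⁻¹ ∙ u ∙ v)        ≡⟨ solve monoid ⟩
    v ∙ (u ∙ (u ⁻¹ ∙ (v ⁻¹ ∙ (u ∙ v))))  ≡⟨ cong (v ∙_) (\\-leftDividesˡ u _) ⟩
    v ∙ (v ⁻¹ ∙ (u ∙ v))                 ≡⟨ \\-leftDividesˡ v _ ⟩
    u ∙ v                                ∎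

  comm≡e⇒commute : ∀ {u v} → comm u v ≡ e → Commute u v
  comm≡e⇒commute {u} {v} eq = trans (sym (∙-comm u v)) (trans (cong (v ∙ u ∙_) eq) (identityʳ _))

  commute⇒comm≡e : ∀ {u v} → Commute u v → comm u v ≡ e
  commute⇒comm≡e {u} {v} uv = ∙-cancelˡ (v ∙ u) _ _ (trans (∙-comm u v) (trans uv (sym (identityʳ _))))

  comm-self : ∀ u → comm u u ≡ e
  comm-self u = commute⇒comm≡e refl

  comm-eˡ : ∀ v → comm e v ≡ e
  comm-eˡ v = commute⇒comm≡e (sym (commute-e v))

  comm-swap : ∀ u v → comm v u ≡ comm u v ⁻¹
  comm-swap u v = inverseʳ-unique (comm u v) (comm v u) (begin
    u ⁻¹ ∙ v ⁻¹ ∙ u ∙ v ∙ (v ⁻¹ ∙ u ⁻¹ ∙ v ∙ u)             ≡⟨ solve monoid ⟩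
    u ⁻¹ ∙ (v ⁻¹ ∙ (u ∙ (v ∙ (v ⁻¹ ∙ (u ⁻¹ ∙ (v ∙ u))))))  ≡⟨ cong (λ w → u ⁻¹ ∙ (v ⁻¹ ∙ (u ∙ w))) (\\-leftDividesˡ v _) ⟩
    u ⁻¹ ∙ (v ⁻¹ ∙ (u ∙ (u ⁻¹ ∙ (v ∙ u))))                 ≡⟨ cong (λ w → u ⁻¹ ∙ (v ⁻¹ ∙ w)) (\\-leftDividesˡ u _) ⟩
    u ⁻¹ ∙ (v ⁻¹ ∙ (v ∙ u))                                ≡⟨ cong (u ⁻¹ ∙_) (\\-leftDividesʳ v u) ⟩
    u ⁻¹ ∙ u                                               ≡⟨ inverseˡ u ⟩
    e                                                      ∎)

  comm-∙ˡ : ∀ m n v → Commute (comm m v) n → comm (m ∙ n) v ≡ comm m v ∙ comm n v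
  comm-∙ˡ m n v commutes = begin
    (m ∙ n) ⁻¹ ∙ v ⁻¹ ∙ (m ∙ n) ∙ v                      ≡⟨ cong (λ w → w ∙ v ⁻¹ ∙ (m ∙ n) ∙ v) (⁻¹-anti-homo-∙ m n) ⟩
    n ⁻¹ ∙ m ⁻¹ ∙ v ⁻¹ ∙ (m ∙ n) ∙ v                     ≡⟨ cong (λ w → n ⁻¹ ∙ m ⁻¹ ∙ v ⁻¹ ∙ (m ∙ w) ∙ v) (sym (\\-leftDividesˡ v n)) ⟩
    n ⁻¹ ∙ m ⁻¹ ∙ v ⁻¹ ∙ (m ∙ (v ∙ (v ⁻¹ ∙ n))) ∙ v     ≡⟨ solve monoid ⟩
    (n ⁻¹ ∙ comm m v) ∙ (v ⁻¹ ∙ n ∙ v)                  ≡⟨ cong (_∙ (v ⁻¹ ∙ n ∙ v)) (sym (commute-⁻¹ commutes)) ⟩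
    (comm m v ∙ n ⁻¹) ∙ (v ⁻¹ ∙ n ∙ v)                  ≡⟨ solve monoid ⟩
    comm m v ∙ comm n v                                  ∎

  comm-∙-commuting : ∀ u y w → Commute w u → Commute w y → comm u (y ∙ w) ≡ comm u y
  comm-∙-commuting u y w wu wy = begin
    u ⁻¹ ∙ (y ∙ w) ⁻¹ ∙ u ∙ (y ∙ w)         ≡⟨ cong (λ z → u ⁻¹ ∙ z ∙ u ∙ (y ∙ w)) (⁻¹-anti-homo-∙ y w) ⟩
    u ⁻¹ ∙ (w ⁻¹ ∙ y ⁻¹) ∙ u ∙ (y ∙ w)      ≡⟨ solve monoid ⟩
    (u ⁻¹ ∙ w ⁻¹) ∙ (y ⁻¹ ∙ u ∙ y) ∙ w      ≡⟨ cong (λ z → z ∙ (y ⁻¹ ∙ u ∙ y) ∙ w) (commute-⁻¹ (sym (commute-⁻¹ wu))) ⟩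
    (w ⁻¹ ∙ u ⁻¹) ∙ (y ⁻¹ ∙ u ∙ y) ∙ w      ≡⟨ solve monoid ⟩
    w ⁻¹ ∙ (comm u y ∙ w)                    ≡⟨ cong (w ⁻¹ ∙_) (sym w-comm) ⟩
    w ⁻¹ ∙ (w ∙ comm u y)                    ≡⟨ \\-leftDividesʳ w _ ⟩
    comm u y                                 ∎
    where
    w-comm : Commute w (comm u y)
    w-comm = commute-∙ (commute-∙ (commute-∙ (commute-⁻¹ wu) (commute-⁻¹ wy)) wu) wy

  cyclic-involution : ∀ {c g} → c ∙ c ≡ e → cyclic c g → (g ≡ e) ⊎ (g ≡ c)
  cyclic-involution c²≡e (gen refl) = inj₂ refl
  cyclic-involution c²≡e unit       = inj₁ refl
  cyclic-involution {c} c²≡e (mul p q) with cyclic-involution c²≡e p | cyclic-involution c²≡e q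
  ... | inj₁ refl | inj₁ refl = inj₁ (identityˡ e)
  ... | inj₁ refl | inj₂ refl = inj₂ (identityˡ c)
  ... | inj₂ refl | inj₁ refl = inj₂ (identityʳ c)
  ... | inj₂ refl | inj₂ refl = inj₁ c²≡e
  cyclic-involution {c} c²≡e (inv p) with cyclic-involution c²≡e p
  ... | inj₁ refl = inj₁ ε⁻¹≈ε
  ... | inj₂ refl = inj₂ (sym (inverseʳ-unique c c c²≡e))

  Ω₁Z : Elt → Set
  Ω₁Z g = (g ∙ g ≡ e) × (∀ h → Commute g h)

  Ω₁Z-e : Ω₁Z e
  Ω₁Z-e = identityˡ e , λ h → sym (commute-e h)

  Ω₁Z-∙ : ∀ {g h} → Ω₁Z g → Ω₁Z h → Ω₁Z (g ∙ h)
  Ω₁Z-∙ {g} {h} (gg , g-central) (hh , h-central) =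
    square , λ k → sym (commute-∙ (sym (g-central k)) (sym (h-central k)))
    where
    square : (g ∙ h) ∙ (g ∙ h) ≡ e
    square = begin
      (g ∙ h) ∙ (g ∙ h) ≡⟨ interchange g h g h (sym (g-central h)) ⟩
      (g ∙ g) ∙ (h ∙ h) ≡⟨ cong₂ _∙_ gg hh ⟩
      e ∙ e             ≡⟨ identityˡ e ⟩
      e                 ∎


  DistinctCosets : Pred → Elt → Elt → Set
  DistinctCosets H x y = ¬ H (x ⁻¹ ∙ y)

  CosetWithin : Pred → Pred → Elt → Set
  CosetWithin H P g = ∀ t → H t → P (g ∙ t)

  HasSize-decidable : ∀ {P k} → HasSize P k → ∀ x → Dec (P x)
  HasSize-decidable (S , S⇔P , _) x =
    map′ (Equivalence.to (S⇔P x)) (Equivalence.from (S⇔P x)) (x ∈? S)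

  HasSize-everything : HasSize (λ _ → Unit) n
  HasSize-everything = ⊤ , (λ _ → mk⇔ (λ _ → tt) (λ _ → ∈⊤)) , ∣⊤∣≡n n

  module _ {H : Pred} (H-subgroup : IsSubgroup H) where
    open IsSubgroup H-subgroup

    distinctCosets-sym : Symmetric (DistinctCosets H)
    distinctCosets-sym {x} {y} x≁y y~x =
      x≁y (subst H (trans (⁻¹-anti-homo-∙ (y ⁻¹) x) (cong (x ⁻¹ ∙_) (⁻¹-involutive y))) (has-⁻¹ y~x))

    cosets-fit : ∀ {h P s} → HasSize H h → HasSize P s → (gs : List Elt) →
                 All (CosetWithin H P) gs → AllPairs (DistinctCosets H) gs → length gs * h ≤ s
    cosets-fit (SH , SH⇔H , refl) (SP , SP⇔P , refl) gs gsH⊆P distinct =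
      injective⇒≤ {f = f} f-injective
      where
      g : Fin (length gs) → Elt
      g = lookup gs
      t : Fin ∣ SH ∣ → Elt
      t = enum SH
      H-t : ∀ j → H (t j)
      H-t j = Equivalence.to (SH⇔H (t j)) (enum-∈ SH j)
      gt∈SP : ∀ (ij : Fin (length gs) × Fin ∣ SH ∣) → g (proj₁ ij) ∙ t (proj₂ ij) ∈ SP
      gt∈SP (i , j) = Equivalence.from (SP⇔P _) (All.lookup gsH⊆P (∈-lookup i) (t j) (H-t j))
      f : Fin (length gs * ∣ SH ∣) → Fin ∣ SP ∣
      f u = index SP (gt∈SP (remQuot {length gs} ∣ SH ∣ u))
      pair-injective : ∀ ij kl → g (proj₁ ij) ∙ t (proj₂ ij) ≡ g (proj₁ kl) ∙ t (proj₂ kl) → ij ≡ kl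
      pair-injective (i , j) (k , l) eq = cong₂ _,_ i≡k (enum-injective SH (∙-cancelˡ (g i) _ _ (trans eq (cong (λ m → g m ∙ t l) (sym i≡k)))))
        where
        same-coset : H (g i ⁻¹ ∙ g k)
        same-coset = subst H (sym (begin
          g i ⁻¹ ∙ g k                    ≡⟨ cong (g i ⁻¹ ∙_) (x≈z//y (g k) (t l) _ (sym eq)) ⟩
          g i ⁻¹ ∙ (g i ∙ t j ∙ t l ⁻¹)   ≡⟨ cong (g i ⁻¹ ∙_) (assoc _ _ _) ⟩
          g i ⁻¹ ∙ (g i ∙ (t j ∙ t l ⁻¹)) ≡⟨ \\-leftDividesʳ (g i) _ ⟩
          t j ∙ t l ⁻¹                    ∎)) (has-∙ (H-t j) (has-⁻¹ (H-t l)))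
        i≡k : i ≡ k
        i≡k = decidable-stable (i ≟ᶠ k) (λ i≢k → allPairs-lookup distinctCosets-sym distinct i k i≢k same-coset)
      f-injective : ∀ {u v} → f u ≡ f v → u ≡ v
      f-injective {u} {v} eq = begin
        u                                        ≡⟨ sym (combine-remQuot {length gs} ∣ SH ∣ u) ⟩
        uncurry combine (remQuot {length gs} ∣ SH ∣ u) ≡⟨ cong (uncurry combine) (pair-injective _ _ (index-injective SP _ _ eq)) ⟩
        uncurry combine (remQuot {length gs} ∣ SH ∣ v) ≡⟨ combine-remQuot {length gs} ∣ SH ∣ v ⟩
        v                                        ∎

    cosets≤index : ∀ {h P k} → HasSize H h → HasSize P (k * h) → (gs : List Elt) →
                   All (CosetWithin H P) gs → AllPairs (DistinctCosets H) gs → length gs ≤ k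
    cosets≤index {k = k} H-size@(SH , SH⇔H , refl) P-size gs gs⊆P distinct =
      *-cancelʳ-≤ (length gs) k ∣ SH ∣ {{nonZeroIndex (index SH (Equivalence.from (SH⇔H e) has-e))}}
        (cosets-fit H-size P-size gs gs⊆P distinct)

  module CentralTwist (θ : Elt → Elt) (θ-hom : ∀ g h → θ (g ∙ h) ≡ θ g ∙ θ h)
                      (θ-Ω₁Z : ∀ g → Ω₁Z (θ g)) (θ∘θ≡e : ∀ g → θ (θ g) ≡ e) where

    twist : Elt → Elt
    twist g = g ∙ θ g

    twist-hom : ∀ g h → twist (g ∙ h) ≡ twist g ∙ twist h
    twist-hom g h = begin
      g ∙ h ∙ θ (g ∙ h)       ≡⟨ cong (g ∙ h ∙_) (θ-hom g h) ⟩
      g ∙ h ∙ (θ g ∙ θ h)     ≡⟨ solve monoid ⟩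
      g ∙ (h ∙ θ g) ∙ θ h     ≡⟨ cong (λ u → g ∙ u ∙ θ h) (sym (proj₂ (θ-Ω₁Z g) h)) ⟩
      g ∙ (θ g ∙ h) ∙ θ h     ≡⟨ solve monoid ⟩
      (g ∙ θ g) ∙ (h ∙ θ h)   ∎

    twist-involutive : ∀ g → twist (twist g) ≡ g
    twist-involutive g = begin
      g ∙ θ g ∙ θ (g ∙ θ g)         ≡⟨ cong (g ∙ θ g ∙_) (θ-hom g (θ g)) ⟩
      g ∙ θ g ∙ (θ g ∙ θ (θ g))     ≡⟨ cong (λ u → g ∙ θ g ∙ (θ g ∙ u)) (θ∘θ≡e g) ⟩
      g ∙ θ g ∙ (θ g ∙ e)           ≡⟨ solve monoid ⟩
      g ∙ (θ g ∙ θ g)               ≡⟨ cong (g ∙_) (proj₁ (θ-Ω₁Z g)) ⟩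
      g ∙ e                         ≡⟨ identityʳ g ⟩
      g                             ∎

    twist-automorphism : IsAutomorphism twist
    twist-automorphism = record
      { hom        = twist-hom
      ; injective  = λ {g} {h} eq → trans (sym (twist-involutive g)) (trans (cong twist eq) (twist-involutive h))
      ; surjective = λ g → twist g , λ eq → trans (cong twist eq) (twist-involutive g)
      }

    twist-moves : ∀ g → θ g ≢ e → twist g ≢ g
    twist-moves g θg≢e eq = θg≢e (∙-cancelˡ g _ _ (trans eq (sym (identityʳ g))))

    twist-fixes : ∀ g → θ g ≡ e → twist g ≡ g
    twist-fixes g θg≡e = trans (cong (g ∙_) θg≡e) (identityʳ g)

    twist-inverts : ∀ g → (g ∙ g) ∙ θ g ≡ e → twist g ≡ g ⁻¹
    twist-inverts g g²θg≡e = trans (y≈x\\z g (twist g) e (trans (sym (assoc g g (θ g))) g²θg≡e)) (identityʳ (g ⁻¹))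

  module IndexTwo (M : Pred) (M-subgroup : IsSubgroup M)
                  (M-index : HasIndex M 2) (a : Elt) (a∉M : ¬ M a) where
    open IsSubgroup M-subgroup

    M? : ∀ g → Dec (M g)
    M? = HasSize-decidable (proj₁ (proj₂ M-index))

    no-third-coset : ∀ {g} → ¬ M g → ¬ M (a ⁻¹ ∙ g) → ⊥
    no-third-coset {g} g∉M a⁻¹g∉M
      with cosets≤index M-subgroup {k = 2} (proj₁ (proj₂ M-index)) R-size (e ∷ a ∷ g ∷ [])
                        (All.universal (λ _ _ _ → tt) (e ∷ a ∷ g ∷ [])) distinct
      where
      R-size : HasSize (λ _ → Unit) (2 * proj₁ M-index)
      R-size = subst (HasSize (λ _ → Unit)) (proj₂ (proj₂ M-index)) HasSize-everything
      separate : ∀ {x} → ¬ M x → DistinctCosets M e x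
      separate x∉M = x∉M ∘ subst M (trans (cong (_∙ _) ε⁻¹≈ε) (identityˡ _))
      distinct : AllPairs (DistinctCosets M) (e ∷ a ∷ g ∷ [])
      distinct = (separate a∉M ∷ separate g∉M ∷ []) ∷ (a⁻¹g∉M ∷ []) ∷ [] ∷ []
    ... | s≤s (s≤s ())

    ∉M⇒a⁻¹∙∈M : ∀ {g} → ¬ M g → M (a ⁻¹ ∙ g)
    ∉M⇒a⁻¹∙∈M {g} g∉M = decidable-stable (M? (a ⁻¹ ∙ g)) (no-third-coset g∉M)

    M-∙-∉M : ∀ {g h} → M g → ¬ M h → ¬ M (g ∙ h)
    M-∙-∉M {g} {h} g∈M h∉M gh∈M = h∉M (subst M (\\-leftDividesʳ g h) (has-∙ (has-⁻¹ g∈M) gh∈M))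

    ∉M-∙-M : ∀ {g h} → ¬ M g → M h → ¬ M (g ∙ h)
    ∉M-∙-M {g} {h} g∉M h∈M gh∈M = g∉M (subst M (//-rightDividesʳ h g) (has-∙ gh∈M (has-⁻¹ h∈M)))

    τ : Elt → Elt
    τ m = conj m a

    M-τ : ∀ {m} → M m → M (τ m)
    M-τ {m} m∈M = subst M (sym (assoc (a ⁻¹) m a)) (∉M⇒a⁻¹∙∈M (M-∙-∉M m∈M a∉M))

    a∙M∌e : ∀ {m} → M m → a ∙ m ≢ e
    a∙M∌e {m} m∈M am≡e = a∉M (subst M (sym (inverseˡ-unique a m am≡e)) (has-⁻¹ m∈M))

    a²∈M : M (a ∙ a)
    a²∈M = decidable-stable (M? (a ∙ a)) (λ a²∉M → a∉M (subst M (\\-leftDividesʳ a a) (∉M⇒a⁻¹∙∈M a²∉M)))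

    outside-product : ∀ m m' → (a ∙ m) ∙ (a ∙ m') ≡ (a ∙ a) ∙ τ m ∙ m'
    outside-product m m' = begin
      (a ∙ m) ∙ (a ∙ m')                 ≡⟨ cong (λ u → (a ∙ u) ∙ (a ∙ m')) (sym (\\-leftDividesˡ a m)) ⟩
      (a ∙ (a ∙ (a ⁻¹ ∙ m))) ∙ (a ∙ m')  ≡⟨ solve monoid ⟩
      (a ∙ a) ∙ (a ⁻¹ ∙ m ∙ a) ∙ m'      ∎

    ∉M-product : ∀ {g h} → ¬ M g → ¬ M h → g ∙ h ≡ (a ∙ a) ∙ τ (a ⁻¹ ∙ g) ∙ (a ⁻¹ ∙ h)
    ∉M-product {g} {h} _ _ =
      trans (sym (cong₂ _∙_ (\\-leftDividesˡ a g) (\\-leftDividesˡ a h))) (outside-product _ _)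

    ∉M-∙-∉M : ∀ {g h} → ¬ M g → ¬ M h → M (g ∙ h)
    ∉M-∙-∉M g∉M h∉M = subst M (sym (∉M-product g∉M h∉M))
      (has-∙ (has-∙ a²∈M (M-τ (∉M⇒a⁻¹∙∈M g∉M))) (∉M⇒a⁻¹∙∈M h∉M))

    commutes-with-M-and-a⇒central : ∀ {g} → (∀ m → M m → Commute g m) → Commute g a → ∀ h → Commute g h
    commutes-with-M-and-a⇒central {g} g-M g-a h with M? h
    ... | yes h∈M = g-M h h∈M
    ... | no  h∉M = subst (Commute g) (\\-leftDividesˡ a h) (commute-∙ g-a (g-M _ (∉M⇒a⁻¹∙∈M h∉M)))

    μ : Elt → Elt
    μ g with M? g
    ... | yes _ = g
    ... | no  _ = a ⁻¹ ∙ g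

    μ-∈M : ∀ {g} → M g → μ g ≡ g
    μ-∈M {g} g∈M with M? g
    ... | yes _   = refl
    ... | no  g∉M = ⊥-elim (g∉M g∈M)

    μ-∉M : ∀ {g} → ¬ M g → μ g ≡ a ⁻¹ ∙ g
    μ-∉M {g} g∉M with M? g
    ... | yes g∈M = ⊥-elim (g∉M g∈M)
    ... | no  _   = refl

    M-μ : ∀ g → M (μ g)
    M-μ g with M? g
    ... | yes g∈M = g∈M
    ... | no  g∉M = ∉M⇒a⁻¹∙∈M g∉M

    module _ (z : Elt) where

      indicator : Elt → Elt
      indicator g with M? g
      ... | yes _ = e
      ... | no  _ = z

      indicator-∈M : ∀ {g} → M g → indicator g ≡ e
      indicator-∈M {g} g∈M with M? g
      ... | yes _   = refl
      ... | no  g∉M = ⊥-elim (g∉M g∈M)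

      indicator-∉M : ∀ {g} → ¬ M g → indicator g ≡ z
      indicator-∉M {g} g∉M with M? g
      ... | yes g∈M = ⊥-elim (g∉M g∈M)
      ... | no  _   = refl

      indicator-∈ : ∀ (P : Pred) → P e → P z → ∀ g → P (indicator g)
      indicator-∈ P Pe Pz g with M? g
      ... | yes _ = Pe
      ... | no  _ = Pz

      indicator-hom : z ∙ z ≡ e → ∀ g h → indicator (g ∙ h) ≡ indicator g ∙ indicator h
      indicator-hom z²≡e g h with M? g | M? h
      ... | yes g∈M | yes h∈M = trans (indicator-∈M (has-∙ g∈M h∈M)) (sym (identityˡ e))
      ... | yes g∈M | no  h∉M = trans (indicator-∉M (M-∙-∉M g∈M h∉M)) (sym (identityˡ z))
      ... | no  g∉M | yes h∈M = trans (indicator-∉M (∉M-∙-M g∉M h∈M)) (sym (identityʳ z))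
      ... | no  g∉M | no  h∉M = trans (indicator-∈M (∉M-∙-∉M g∉M h∉M)) (sym z²≡e)

    module _ (F : Elt → Elt) (F-hom : ∀ {m m'} → M m → M m' → F (m ∙ m') ≡ F m ∙ F m')
             (F-τ : ∀ {m} → M m → F (τ m) ≡ F m) (F-a² : F (a ∙ a) ≡ e) where

      F∘μ-hom : ∀ g h → F (μ (g ∙ h)) ≡ F (μ g) ∙ F (μ h)
      F∘μ-hom g h with M? g | M? h
      ... | yes g∈M | yes h∈M = begin
        F (μ (g ∙ h))            ≡⟨ cong F (μ-∈M (has-∙ g∈M h∈M)) ⟩
        F (g ∙ h)                ≡⟨ F-hom g∈M h∈M ⟩
        F g ∙ F h                ∎
      ... | yes g∈M | no  h∉M = begin
        F (μ (g ∙ h))            ≡⟨ cong F (μ-∉M (M-∙-∉M g∈M h∉M)) ⟩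
        F (a ⁻¹ ∙ (g ∙ h))       ≡⟨ cong F (trans (cong (λ u → a ⁻¹ ∙ (g ∙ u)) (sym (\\-leftDividesˡ a h))) (solve monoid)) ⟩
        F (τ g ∙ (a ⁻¹ ∙ h))     ≡⟨ F-hom (M-τ g∈M) (∉M⇒a⁻¹∙∈M h∉M) ⟩
        F (τ g) ∙ F (a ⁻¹ ∙ h)   ≡⟨ cong (_∙ F (a ⁻¹ ∙ h)) (F-τ g∈M) ⟩
        F g ∙ F (a ⁻¹ ∙ h)       ∎
      ... | no  g∉M | yes h∈M = begin
        F (μ (g ∙ h))            ≡⟨ cong F (μ-∉M (∉M-∙-M g∉M h∈M)) ⟩
        F (a ⁻¹ ∙ (g ∙ h))       ≡⟨ cong F (sym (assoc _ _ _)) ⟩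
        F ((a ⁻¹ ∙ g) ∙ h)       ≡⟨ F-hom (∉M⇒a⁻¹∙∈M g∉M) h∈M ⟩
        F (a ⁻¹ ∙ g) ∙ F h       ∎
      ... | no  g∉M | no  h∉M = begin
        F (μ (g ∙ h))                                ≡⟨ cong F (μ-∈M (∉M-∙-∉M g∉M h∉M)) ⟩
        F (g ∙ h)                                    ≡⟨ cong F (∉M-product g∉M h∉M) ⟩
        F ((a ∙ a) ∙ τ (a ⁻¹ ∙ g) ∙ (a ⁻¹ ∙ h))      ≡⟨ F-hom (has-∙ a²∈M (M-τ m∈M)) m'∈M ⟩
        F ((a ∙ a) ∙ τ (a ⁻¹ ∙ g)) ∙ F (a ⁻¹ ∙ h)    ≡⟨ cong (_∙ F (a ⁻¹ ∙ h)) (F-hom a²∈M (M-τ m∈M)) ⟩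
        F (a ∙ a) ∙ F (τ (a ⁻¹ ∙ g)) ∙ F (a ⁻¹ ∙ h)  ≡⟨ cong₂ (λ u v → u ∙ v ∙ F (a ⁻¹ ∙ h)) F-a² (F-τ m∈M) ⟩
        e ∙ F (a ⁻¹ ∙ g) ∙ F (a ⁻¹ ∙ h)              ≡⟨ cong (_∙ F (a ⁻¹ ∙ h)) (identityˡ _) ⟩
        F (a ⁻¹ ∙ g) ∙ F (a ⁻¹ ∙ h)                  ∎
        where
        m∈M = ∉M⇒a⁻¹∙∈M g∉M
        m'∈M = ∉M⇒a⁻¹∙∈M h∉M

  module CentreOfIndexFour (M : Pred) (M-subgroup : IsSubgroup M)
                           (M-centre-index : CentreIndex M 4) where
    open IsSubgroup M-subgroup

    Z : Pred
    Z = Centre M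

    Z-subgroup : IsSubgroup Z
    Z-subgroup = record
      { has-e  = has-e , λ m _ → sym (commute-e m)
      ; has-∙  = λ (x∈M , x-central) (y∈M , y-central) → has-∙ x∈M y∈M ,
                   λ m m∈M → sym (commute-∙ (sym (x-central m m∈M)) (sym (y-central m m∈M)))
      ; has-⁻¹ = λ (x∈M , x-central) → has-⁻¹ x∈M , λ m m∈M → sym (commute-⁻¹ (sym (x-central m m∈M)))
      }

    central∩M⊆Z : ∀ {g} → (∀ h → Commute g h) → M g → Z g
    central∩M⊆Z g-central g∈M = g∈M , λ m _ → g-central m

    module _ {x y : Elt} (x∈M : M x) (y∈M : M y)
             (four-cosets : AllPairs (DistinctCosets Z) (e ∷ x ∷ y ∷ x ∙ y ∷ [])) where

      no-fifth-coset : ∀ {w} → M w → ¬ All (λ r → DistinctCosets Z r w) (e ∷ x ∷ y ∷ x ∙ y ∷ [])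
      no-fifth-coset {w} w∈M w-separated
        with cosets≤index Z-subgroup {k = 4} Z-size M-size (e ∷ x ∷ y ∷ x ∙ y ∷ w ∷ [])
               (in-M has-e ∷ in-M x∈M ∷ in-M y∈M ∷ in-M (has-∙ x∈M y∈M) ∷ in-M w∈M ∷ [])
               (AllPairs.++⁺ four-cosets ([] ∷ []) (All.map (_∷ []) w-separated))
        where
        Z-size = proj₁ (proj₂ (proj₂ (proj₂ M-centre-index)))
        M-size = subst (HasSize M) (proj₂ (proj₂ (proj₂ (proj₂ M-centre-index))))
                   (proj₁ (proj₂ (proj₂ M-centre-index)))
        in-M : ∀ {g} → M g → CosetWithin Z M g
        in-M g∈M t t∈Z = has-∙ g∈M (proj₁ t∈Z)
      ... | s≤s (s≤s (s≤s (s≤s ())))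

      commutes-with-x-and-y⇒central : ∀ {m} → M m → Commute m x → Commute m y → Z m
      commutes-with-x-and-y⇒central {m} m∈M mx my =
        m∈M , λ w w∈M → decidable-stable (m ∙ w ≟ᶠ w ∙ m) (λ ¬mw →
          no-fifth-coset w∈M (All.map (separate ¬mw) (commute-e m ∷ mx ∷ my ∷ commute-∙ mx my ∷ [])))
        where
        separate : ∀ {w r} → ¬ Commute m w → Commute m r → DistinctCosets Z r w
        separate {w} {r} ¬mw mr r⁻¹w∈Z =
          ¬mw (subst (Commute m) (\\-leftDividesˡ r w) (commute-∙ mr (sym (proj₂ r⁻¹w∈Z m m∈M))))

  module KleinQuotient (M : Pred) (M-subgroup : IsSubgroup M)
                       (M-centre-index : CentreIndex M 4) (c : Elt) (c²≡e : c ∙ c ≡ e) (c≢e : c ≢ e)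
                       (comm-∈C₂ : ∀ {u v} → M u → M v → (comm u v ≡ e) ⊎ (comm u v ≡ c)) where
    open CentreOfIndexFour M M-subgroup M-centre-index public
    open IsSubgroup M-subgroup

    C₂ : Pred
    C₂ g = (g ≡ e) ⊎ (g ≡ c)

    C₂-∙ : ∀ {g h} → C₂ g → C₂ h → C₂ (g ∙ h)
    C₂-∙ (inj₁ refl) h∈C₂ = subst C₂ (sym (identityˡ _)) h∈C₂
    C₂-∙ (inj₂ refl) (inj₁ refl) = inj₂ (identityʳ c)
    C₂-∙ (inj₂ refl) (inj₂ refl) = inj₁ c²≡e

    c⁻¹≡c : c ⁻¹ ≡ c
    c⁻¹≡c = sym (inverseʳ-unique c c c²≡e)

    NonCommutingPair : Set
    NonCommutingPair = ∃ λ x → ∃ λ y → M x × M y × (comm x y ≡ c)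

    γ₂-trivial-or-pair : ∀ {g} → γ₂ M g → (g ≡ e) ⊎ NonCommutingPair
    γ₂-trivial-or-pair unit = inj₁ refl
    γ₂-trivial-or-pair (gen (u , v , u∈M , v∈M , refl)) with comm-∈C₂ u∈M v∈M
    ... | inj₁ [u,v]≡e = inj₁ [u,v]≡e
    ... | inj₂ [u,v]≡c = inj₂ (u , v , u∈M , v∈M , [u,v]≡c)
    γ₂-trivial-or-pair (mul p q) with γ₂-trivial-or-pair p | γ₂-trivial-or-pair q
    ... | inj₁ refl | inj₁ refl = inj₁ (identityˡ e)
    ... | inj₂ pair | _         = inj₂ pair
    ... | inj₁ _    | inj₂ pair = inj₂ pair
    γ₂-trivial-or-pair (inv p) with γ₂-trivial-or-pair p
    ... | inj₁ refl = inj₁ ε⁻¹≈ε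
    ... | inj₂ pair = inj₂ pair

    comm≡c⇒c∈Z : ∀ {x y} → M x → M y → comm x y ≡ c → Z c
    comm≡c⇒c∈Z {x} {y} x∈M y∈M [x,y]≡c = c∈M , c-central
      where
      c∈M : M c
      c∈M = subst M [x,y]≡c (has-∙ (has-∙ (has-∙ (has-⁻¹ x∈M) (has-⁻¹ y∈M)) x∈M) y∈M)
      M-conj : ∀ {u m} → M u → M m → M (conj u m)
      M-conj u∈M m∈M = has-∙ (has-∙ (has-⁻¹ m∈M) u∈M) m∈M
      c-central : ∀ m → M m → Commute c m
      c-central m m∈M = trans (sym (∙-conj c m)) (cong (m ∙_) c^m≡c)
        where
        c^m≡[xᵐ,yᵐ] : conj c m ≡ comm (conj x m) (conj y m)
        c^m≡[xᵐ,yᵐ] = trans (cong (λ u → conj u m) (sym [x,y]≡c)) (comm-conj x y m)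
        -- c^m is again a commutator of M, and it is not e because c is not
        c^m≡c : conj c m ≡ c
        c^m≡c with comm-∈C₂ (M-conj x∈M m∈M) (M-conj y∈M m∈M)
        ... | inj₁ [xᵐ,yᵐ]≡e = ⊥-elim (c≢e (conj≡e⇒≡e (trans c^m≡[xᵐ,yᵐ] [xᵐ,yᵐ]≡e)))
        ... | inj₂ [xᵐ,yᵐ]≡c = trans c^m≡[xᵐ,yᵐ] [xᵐ,yᵐ]≡c

    module WithCentralC (c∈Z : Z c) where
      private module Z-subgroup = IsSubgroup Z-subgroup

      C₂⊆Z : ∀ {g} → C₂ g → Z g
      C₂⊆Z (inj₁ refl) = Z-subgroup.has-e
      C₂⊆Z (inj₂ refl) = c∈Z

      C₂-square : ∀ {g} → C₂ g → g ∙ g ≡ e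
      C₂-square (inj₁ refl) = identityˡ e
      C₂-square (inj₂ refl) = c²≡e

      comm-∙ˡ-M : ∀ {m m' v} → M m → M m' → M v → comm (m ∙ m') v ≡ comm m v ∙ comm m' v
      comm-∙ˡ-M m∈M m'∈M v∈M = comm-∙ˡ _ _ _ (proj₂ (C₂⊆Z (comm-∈C₂ m∈M v∈M)) _ m'∈M)

      comm-Z : ∀ {z v} → Z z → M v → comm z v ≡ e
      comm-Z z∈Z v∈M = commute⇒comm≡e (proj₂ z∈Z _ v∈M)

      comm-coset : ∀ {r m v} → M r → Z (r ⁻¹ ∙ m) → M v → comm m v ≡ comm r v
      comm-coset {r} {m} {v} r∈M r⁻¹m∈Z v∈M = begin
        comm m v                   ≡⟨ cong (λ u → comm u v) (sym (\\-leftDividesˡ r m)) ⟩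
        comm (r ∙ (r ⁻¹ ∙ m)) v    ≡⟨ comm-∙ˡ-M r∈M (proj₁ r⁻¹m∈Z) v∈M ⟩
        comm r v ∙ comm (r ⁻¹ ∙ m) v ≡⟨ cong (comm r v ∙_) (comm-Z r⁻¹m∈Z v∈M) ⟩
        comm r v ∙ e               ≡⟨ identityʳ _ ⟩
        comm r v                   ∎

      comm-⁻¹ˡ : ∀ {m v} → M m → M v → comm (m ⁻¹) v ≡ comm m v ⁻¹
      comm-⁻¹ˡ {m} {v} m∈M v∈M = inverseˡ-unique _ _ (begin
        comm (m ⁻¹) v ∙ comm m v  ≡⟨ sym (comm-∙ˡ-M (has-⁻¹ m∈M) m∈M v∈M) ⟩
        comm (m ⁻¹ ∙ m) v         ≡⟨ cong (λ u → comm u v) (inverseˡ m) ⟩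
        comm e v                  ≡⟨ comm-eˡ v ⟩
        e                         ∎)

      square-∈Z : ∀ {m} → M m → Z (m ∙ m)
      square-∈Z {m} m∈M = has-∙ m∈M m∈M , λ n n∈M → let k = comm m n ; k∈Z = C₂⊆Z (comm-∈C₂ m∈M n∈M) in begin
        (m ∙ m) ∙ n          ≡⟨ assoc m m n ⟩
        m ∙ (m ∙ n)          ≡⟨ cong (m ∙_) (sym (∙-comm m n)) ⟩
        m ∙ (n ∙ m ∙ k)      ≡⟨ solve monoid ⟩
        (m ∙ n) ∙ (m ∙ k)    ≡⟨ cong (_∙ (m ∙ k)) (sym (∙-comm m n)) ⟩
        (n ∙ m ∙ k) ∙ (m ∙ k) ≡⟨ solve monoid ⟩
        n ∙ m ∙ (k ∙ m) ∙ k  ≡⟨ cong (λ u → n ∙ m ∙ u ∙ k) (proj₂ k∈Z m m∈M) ⟩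
        n ∙ m ∙ (m ∙ k) ∙ k  ≡⟨ solve monoid ⟩
        n ∙ (m ∙ m) ∙ (k ∙ k) ≡⟨ cong (n ∙ (m ∙ m) ∙_) (C₂-square (comm-∈C₂ m∈M n∈M)) ⟩
        n ∙ (m ∙ m) ∙ e      ≡⟨ identityʳ _ ⟩
        n ∙ (m ∙ m)          ∎

      module Pair {x y : Elt} (x∈M : M x) (y∈M : M y) ([x,y]≡c : comm x y ≡ c) where

        xy∈M : M (x ∙ y)
        xy∈M = has-∙ x∈M y∈M

        [y,x]≡c : comm y x ≡ c
        [y,x]≡c = trans (comm-swap x y) (trans (cong _⁻¹ [x,y]≡c) c⁻¹≡c)

        [xy,x]≡c : comm (x ∙ y) x ≡ c
        [xy,x]≡c = trans (comm-∙ˡ-M x∈M y∈M x∈M) (trans (cong₂ _∙_ (comm-self _) [y,x]≡c) (identityˡ c))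

        [xy,y]≡c : comm (x ∙ y) y ≡ c
        [xy,y]≡c = trans (comm-∙ˡ-M x∈M y∈M y∈M) (trans (cong₂ _∙_ [x,y]≡c (comm-self _)) (identityʳ c))

        [x,xy]≡c : comm x (x ∙ y) ≡ c
        [x,xy]≡c = trans (comm-swap (x ∙ y) x) (trans (cong _⁻¹ [xy,x]≡c) c⁻¹≡c)

        [y,xy]≡c : comm y (x ∙ y) ≡ c
        [y,xy]≡c = trans (comm-swap (x ∙ y) y) (trans (cong _⁻¹ [xy,y]≡c) c⁻¹≡c)

        separated-by : ∀ {r s v p q} → M r → M v → comm r v ≡ p → comm s v ≡ q → p ≢ q → DistinctCosets Z r s
        separated-by r∈M v∈M refl refl [r,v]≢[s,v] r⁻¹s∈Z = [r,v]≢[s,v] (sym (comm-coset r∈M r⁻¹s∈Z v∈M))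

        four-cosets : AllPairs (DistinctCosets Z) (e ∷ x ∷ y ∷ x ∙ y ∷ [])
        four-cosets =
          ( separated-by has-e y∈M (comm-eˡ y) [x,y]≡c e≢c
          ∷ separated-by has-e x∈M (comm-eˡ x) [y,x]≡c e≢c
          ∷ separated-by has-e y∈M (comm-eˡ y) [xy,y]≡c e≢c ∷ [])
          ∷ ( separated-by x∈M y∈M [x,y]≡c (comm-self _) c≢e
            ∷ separated-by x∈M x∈M (comm-self _) [xy,x]≡c e≢c ∷ [])
          ∷ (separated-by y∈M y∈M (comm-self _) [xy,y]≡c e≢c ∷ [])
          ∷ [] ∷ []
          where
          e≢c : e ≢ c
          e≢c = c≢e ∘ sym

        trivial-commutators⇒∈Z : ∀ {m} → M m → comm m x ≡ e → comm m y ≡ e → Z m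
        trivial-commutators⇒∈Z m∈M [m,x]≡e [m,y]≡e =
          commutes-with-x-and-y⇒central x∈M y∈M four-cosets m∈M (comm≡e⇒commute [m,x]≡e) (comm≡e⇒commute [m,y]≡e)

        same-commutators⇒same-coset : ∀ {r m} → M r → M m → comm m x ≡ comm r x → comm m y ≡ comm r y → Z (r ⁻¹ ∙ m)
        same-commutators⇒same-coset {r} {m} r∈M m∈M [m,x]≡[r,x] [m,y]≡[r,y] =
          trivial-commutators⇒∈Z (has-∙ (has-⁻¹ r∈M) m∈M) (cancels x∈M [m,x]≡[r,x]) (cancels y∈M [m,y]≡[r,y])
          where
          cancels : ∀ {v} → M v → comm m v ≡ comm r v → comm (r ⁻¹ ∙ m) v ≡ e
          cancels v∈M [m,v]≡[r,v] = trans (comm-∙ˡ-M (has-⁻¹ r∈M) m∈M v∈M)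
            (trans (cong₂ _∙_ (comm-⁻¹ˡ r∈M v∈M) [m,v]≡[r,v]) (inverseˡ _))

        classify : ∀ {m} → M m → Z m ⊎ Z (x ⁻¹ ∙ m) ⊎ Z (y ⁻¹ ∙ m) ⊎ Z ((x ∙ y) ⁻¹ ∙ m)
        classify m∈M with comm-∈C₂ m∈M x∈M | comm-∈C₂ m∈M y∈M
        ... | inj₁ [m,x]≡e | inj₁ [m,y]≡e = inj₁ (trivial-commutators⇒∈Z m∈M [m,x]≡e [m,y]≡e)
        ... | inj₁ [m,x]≡e | inj₂ [m,y]≡c = inj₂ (inj₁ (same-commutators⇒same-coset x∈M m∈M
                                              (trans [m,x]≡e (sym (comm-self _))) (trans [m,y]≡c (sym [x,y]≡c))))
        ... | inj₂ [m,x]≡c | inj₁ [m,y]≡e = inj₂ (inj₂ (inj₁ (same-commutators⇒same-coset y∈M m∈M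
                                              (trans [m,x]≡c (sym [y,x]≡c)) (trans [m,y]≡e (sym (comm-self _))))))
        ... | inj₂ [m,x]≡c | inj₂ [m,y]≡c = inj₂ (inj₂ (inj₂ (same-commutators⇒same-coset xy∈M m∈M
                                              (trans [m,x]≡c (sym [xy,x]≡c)) (trans [m,y]≡c (sym [xy,y]≡c)))))

        Z-values : ∀ {m} → Z m → (comm m y ≡ e) × (comm m x ≡ e)
        Z-values m∈Z = comm-Z m∈Z y∈M , comm-Z m∈Z x∈M

        x-coset-values : ∀ {m} → Z (x ⁻¹ ∙ m) → (comm m y ≡ c) × (comm m x ≡ e)
        x-coset-values m∈xZ = trans (comm-coset x∈M m∈xZ y∈M) [x,y]≡c , trans (comm-coset x∈M m∈xZ x∈M) (comm-self x)

        y-coset-values : ∀ {m} → Z (y ⁻¹ ∙ m) → (comm m y ≡ e) × (comm m x ≡ c)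
        y-coset-values m∈yZ = trans (comm-coset y∈M m∈yZ y∈M) (comm-self y) , trans (comm-coset y∈M m∈yZ x∈M) [y,x]≡c

        xy-coset-values : ∀ {m} → Z ((x ∙ y) ⁻¹ ∙ m) → (comm m y ≡ c) × (comm m x ≡ c)
        xy-coset-values m∈xyZ = trans (comm-coset xy∈M m∈xyZ y∈M) [xy,y]≡c , trans (comm-coset xy∈M m∈xyZ x∈M) [xy,x]≡c

  module Setting (M : Pred) (M-subgroup : IsSubgroup M)
                 (M-index : HasIndex M 2) (M-centre-index : CentreIndex M 4)
                 (a : Elt) (a∉M : ¬ M a) (o[a]≡4 : HasOrder a 4) (γ₂M≐⟨a²⟩ : γ₂ M ≐ cyclic (a ∙ a))
                 (a-inverts-Z : ∀ z → Centre M z → conj z a ≡ z ⁻¹) where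
    open IsSubgroup M-subgroup
    open IndexTwo M M-subgroup M-index a a∉M

    c : Elt
    c = a ∙ a

    c²≡e : c ∙ c ≡ e
    c²≡e = begin
      (a ∙ a) ∙ (a ∙ a)       ≡⟨ solve monoid ⟩
      a ∙ (a ∙ (a ∙ (a ∙ e))) ≡⟨ proj₁ (proj₂ o[a]≡4) ⟩
      e                       ∎

    c≢e : c ≢ e
    c≢e c≡e = proj₂ (proj₂ o[a]≡4) 2 (s≤s z≤n) (s≤s (s≤s (s≤s z≤n))) (trans (cong (a ∙_) (identityʳ a)) c≡e)

    comm-∈C₂ : ∀ {u v} → M u → M v → (comm u v ≡ e) ⊎ (comm u v ≡ c)
    comm-∈C₂ {u} {v} u∈M v∈M =
      cyclic-involution c²≡e (Equivalence.to (γ₂M≐⟨a²⟩ (comm u v)) (gen (u , v , u∈M , v∈M , refl)))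

    open KleinQuotient M M-subgroup M-centre-index c c²≡e c≢e comm-∈C₂

    pair₀ : NonCommutingPair
    pair₀ with γ₂-trivial-or-pair (Equivalence.from (γ₂M≐⟨a²⟩ c) (gen refl))
    ... | inj₁ c≡e = ⊥-elim (c≢e c≡e)
    ... | inj₂ pair = pair

    c∈Z : Z c
    c∈Z = let (_ , _ , x∈M , y∈M , [x,y]≡c) = pair₀ in comm≡c⇒c∈Z x∈M y∈M [x,y]≡c

    c∈Ω₁Z : Ω₁Z c
    c∈Ω₁Z = c²≡e , commutes-with-M-and-a⇒central (proj₂ c∈Z) (solve monoid)

    C₂⊆Ω₁Z : ∀ {g} → C₂ g → Ω₁Z g
    C₂⊆Ω₁Z (inj₁ refl) = Ω₁Z-e
    C₂⊆Ω₁Z (inj₂ refl) = c∈Ω₁Z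

    open WithCentralC c∈Z
    private module Z-subgroup = IsSubgroup Z-subgroup

    τ-c : τ c ≡ c
    τ-c = conj-commuting (solve monoid)

    τ-C₂ : ∀ {g} → C₂ g → τ g ≡ g
    τ-C₂ (inj₁ refl) = conj-e a
    τ-C₂ (inj₂ refl) = τ-c

    τ-involutive : ∀ {m} → M m → τ (τ m) ≡ m
    τ-involutive {m} m∈M = trans (conj-conj m a a) (conj-commuting (sym (proj₂ c∈Z m m∈M)))

    τ-Z : ∀ {z} → Z z → τ z ≡ z ⁻¹
    τ-Z {z} = a-inverts-Z z

    τ-preserves-comm : ∀ {m r} → M m → M r → comm (τ m) (τ r) ≡ comm m r
    τ-preserves-comm m∈M r∈M = trans (sym (comm-conj _ _ a)) (τ-C₂ (comm-∈C₂ m∈M r∈M))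

    τ⁻¹-Z : ∀ {m} → M m → Z (τ m) → Z m
    τ⁻¹-Z {m} m∈M τm∈Z = subst Z (trans (sym (τ-Z τm∈Z)) (τ-involutive m∈M)) (Z-subgroup.has-⁻¹ τm∈Z)

    square-a∙ : ∀ m → (a ∙ m) ∙ (a ∙ m) ≡ c ∙ τ m ∙ m
    square-a∙ m = outside-product m m

    square-a∙-Z : ∀ {z} → Z z → (a ∙ z) ∙ (a ∙ z) ≡ c
    square-a∙-Z {z} z∈Z = begin
      (a ∙ z) ∙ (a ∙ z) ≡⟨ square-a∙ z ⟩
      c ∙ τ z ∙ z       ≡⟨ cong (λ u → c ∙ u ∙ z) (τ-Z z∈Z) ⟩
      c ∙ z ⁻¹ ∙ z      ≡⟨ //-rightDividesˡ z c ⟩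
      c                 ∎

    square-a∙-coset : ∀ {r m} → M r → Z (r ⁻¹ ∙ m) → (a ∙ m) ∙ (a ∙ m) ≡ (a ∙ r) ∙ (a ∙ r)
    square-a∙-coset {r} {m} r∈M z∈Z = begin
      (a ∙ m) ∙ (a ∙ m)               ≡⟨ square-a∙ m ⟩
      c ∙ τ m ∙ m                     ≡⟨ cong (λ w → c ∙ τ w ∙ w) (sym (\\-leftDividesˡ r m)) ⟩
      c ∙ τ (r ∙ z) ∙ (r ∙ z)         ≡⟨ cong (λ w → c ∙ w ∙ (r ∙ z)) (conj-∙ r z a) ⟩
      c ∙ (τ r ∙ τ z) ∙ (r ∙ z)       ≡⟨ cong (λ w → c ∙ (τ r ∙ w) ∙ (r ∙ z)) (τ-Z z∈Z) ⟩
      c ∙ (τ r ∙ z ⁻¹) ∙ (r ∙ z)      ≡⟨ solve monoid ⟩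
      c ∙ τ r ∙ (z ⁻¹ ∙ r ∙ z)        ≡⟨ cong (c ∙ τ r ∙_) (conj-commuting (sym (proj₂ z∈Z r r∈M))) ⟩
      c ∙ τ r ∙ r                     ≡⟨ sym (square-a∙ r) ⟩
      (a ∙ r) ∙ (a ∙ r)               ∎
      where
      z = r ⁻¹ ∙ m

    FixingPair : Set
    FixingPair = ∃ λ x → ∃ λ y → M x × M y × (comm x y ≡ c) × Z (x ⁻¹ ∙ τ x) × Z (y ⁻¹ ∙ τ y)

    SwappedPair : Set
    SwappedPair = ∃ λ x → ∃ λ y → M x × M y × (comm x y ≡ c) × Z (y ⁻¹ ∙ τ x)

    module _ {x y : Elt} (x∈M : M x) (y∈M : M y) ([x,y]≡c : comm x y ≡ c) where
      open Pair x∈M y∈M [x,y]≡c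

      τ-on-pair : FixingPair ⊎ SwappedPair
      τ-on-pair with classify (M-τ x∈M) | classify (M-τ y∈M)
      ... | inj₁ τx∈Z                  | _ = ⊥-elim (c≢e (trans (sym [x,y]≡c) (comm-Z (τ⁻¹-Z x∈M τx∈Z) y∈M)))
      ... | inj₂ (inj₂ (inj₁ τx∈yZ))   | _ = inj₂ (x , y , x∈M , y∈M , [x,y]≡c , τx∈yZ)
      ... | inj₂ (inj₂ (inj₂ τx∈xyZ))  | _ = inj₂ (x , x ∙ y , x∈M , xy∈M , [x,xy]≡c , τx∈xyZ)
      ... | inj₂ (inj₁ _) | inj₁ τy∈Z = ⊥-elim (c≢e (trans (sym [y,x]≡c) (comm-Z (τ⁻¹-Z y∈M τy∈Z) x∈M)))
      ... | inj₂ (inj₁ τx∈xZ) | inj₂ (inj₁ τy∈xZ) =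
        ⊥-elim (c≢e (trans (sym [x,y]≡c) (trans (sym (comm-coset x∈M x⁻¹y∈Z y∈M)) (comm-self _))))
        where
        -- τ, being injective on M/Z, cannot send both cosets x Z and y Z to x Z
        x⁻¹y∈Z : Z (x ⁻¹ ∙ y)
        x⁻¹y∈Z = τ⁻¹-Z (has-∙ (has-⁻¹ x∈M) y∈M) (subst Z (begin
          (x ⁻¹ ∙ τ x) ⁻¹ ∙ (x ⁻¹ ∙ τ y)  ≡⟨ cong (_∙ (x ⁻¹ ∙ τ y)) (trans (⁻¹-anti-homo-∙ _ _) (cong (τ x ⁻¹ ∙_) (⁻¹-involutive x))) ⟩
          τ x ⁻¹ ∙ x ∙ (x ⁻¹ ∙ τ y)       ≡⟨ trans (assoc _ _ _) (cong (τ x ⁻¹ ∙_) (\\-leftDividesˡ x (τ y))) ⟩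
          τ x ⁻¹ ∙ τ y                    ≡⟨ cong (_∙ τ y) (sym (conj-⁻¹ x a)) ⟩
          τ (x ⁻¹) ∙ τ y                  ≡⟨ sym (conj-∙ (x ⁻¹) y a) ⟩
          τ (x ⁻¹ ∙ y)                    ∎) (Z-subgroup.has-∙ (Z-subgroup.has-⁻¹ τx∈xZ) τy∈xZ))
      ... | inj₂ (inj₁ τx∈xZ) | inj₂ (inj₂ (inj₁ τy∈yZ)) = inj₁ (x , y , x∈M , y∈M , [x,y]≡c , τx∈xZ , τy∈yZ)
      ... | inj₂ (inj₁ _)     | inj₂ (inj₂ (inj₂ τy∈xyZ)) = inj₂ (y , x ∙ y , y∈M , xy∈M , [y,xy]≡c , τy∈xyZ)

    -- τ induces an involution of M/Z ≅ C₂ × C₂: either the identity or a transposition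
    τ-on-M/Z : FixingPair ⊎ SwappedPair
    τ-on-M/Z = let (_ , _ , x∈M , y∈M , [x,y]≡c) = pair₀ in τ-on-pair x∈M y∈M [x,y]≡c

    Conclusion : Set
    Conclusion = ∃ λ (φ : Elt → Elt) → IsAutomorphism φ × (∃ λ g → φ g ≢ g) ×
                   (∀ g → ¬ M g → (φ g ≡ g) ⊎ (φ g ≡ g ⁻¹))

    conclusion-by-twist : (θ : Elt → Elt) → (∀ g h → θ (g ∙ h) ≡ θ g ∙ θ h) → (∀ g → Ω₁Z (θ g)) →
                          (∀ g → θ (θ g) ≡ e) → (∃ λ g → θ g ≢ e) →
                          (∀ g → ¬ M g → (θ g ≡ e) ⊎ ((g ∙ g) ∙ θ g ≡ e)) → Conclusion
    conclusion-by-twist θ θ-hom θ-Ω₁Z θ∘θ≡e (g , θg≢e) θ-outside =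
      twist , twist-automorphism , (g , twist-moves g θg≢e) , λ h h∉M → Sum.map (twist-fixes h) (twist-inverts h) (θ-outside h h∉M)
      where open CentralTwist θ θ-hom θ-Ω₁Z θ∘θ≡e

    comm-τ-coset : ∀ {m r r'} → M m → M r → M r' → Z (r' ⁻¹ ∙ τ r) → comm (τ m) r' ≡ comm m r
    comm-τ-coset {m} {r} {r'} m∈M r∈M r'∈M v∈Z = begin
      comm (τ m) r'        ≡⟨ sym (comm-∙-commuting (τ m) r' v (proj₂ v∈Z (τ m) (M-τ m∈M)) (proj₂ v∈Z r' r'∈M)) ⟩
      comm (τ m) (r' ∙ v)  ≡⟨ cong (comm (τ m)) (\\-leftDividesˡ r' (τ r)) ⟩
      comm (τ m) (τ r)     ≡⟨ τ-preserves-comm m∈M r∈M ⟩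
      comm m r             ∎
      where v = r' ⁻¹ ∙ τ r

    square-a∙-∈Z : ∀ {r} → M r → Z (r ⁻¹ ∙ τ r) → Z ((a ∙ r) ∙ (a ∙ r))
    square-a∙-∈Z {r} r∈M u∈Z = subst Z (sym (begin
      (a ∙ r) ∙ (a ∙ r)    ≡⟨ square-a∙ r ⟩
      c ∙ τ r ∙ r          ≡⟨ cong (λ w → c ∙ w ∙ r) (sym (\\-leftDividesˡ r (τ r))) ⟩
      c ∙ (r ∙ u) ∙ r      ≡⟨ solve monoid ⟩
      c ∙ (r ∙ (u ∙ r))    ≡⟨ cong (λ w → c ∙ (r ∙ w)) (proj₂ u∈Z r r∈M) ⟩
      c ∙ (r ∙ (r ∙ u))    ≡⟨ solve monoid ⟩
      c ∙ ((r ∙ r) ∙ u)    ∎)) (Z-subgroup.has-∙ c∈Z (Z-subgroup.has-∙ (square-∈Z r∈M) u∈Z))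
      where u = r ⁻¹ ∙ τ r

    -- p commutes with a ∙ r and with M, hence is central; a inverts it while fixing it, so p² = e
    square-a∙-∈Ω₁Z : ∀ {r} → M r → Z (r ⁻¹ ∙ τ r) → Ω₁Z ((a ∙ r) ∙ (a ∙ r))
    square-a∙-∈Ω₁Z {r} r∈M u∈Z = p²≡e , commutes-with-M-and-a⇒central (proj₂ p∈Z) p-a
      where
      p = (a ∙ r) ∙ (a ∙ r)
      p∈Z = square-a∙-∈Z r∈M u∈Z
      p-a : Commute p a
      p-a = subst (Commute p) (//-rightDividesʳ r a) (commute-∙ p-ar (proj₂ p∈Z (r ⁻¹) (has-⁻¹ r∈M)))
        where
        p-ar : Commute p (a ∙ r)
        p-ar = solve monoid
      p²≡e : p ∙ p ≡ e
      p²≡e = trans (cong (p ∙_) (trans (sym (conj-commuting p-a)) (τ-Z p∈Z))) (inverseʳ p)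

    square-a∙-∙ : ∀ x y → (a ∙ (x ∙ y)) ∙ (a ∙ (x ∙ y)) ≡ (a ∙ x) ∙ (a ∙ x) ∙ conj (τ y) x ∙ y
    square-a∙-∙ x y = begin
      (a ∙ (x ∙ y)) ∙ (a ∙ (x ∙ y))                ≡⟨ cong (λ w → w ∙ w) (sym (assoc a x y)) ⟩
      ((a ∙ x) ∙ y) ∙ ((a ∙ x) ∙ y)                ≡⟨ square-∙ (a ∙ x) y ⟩
      (a ∙ x) ∙ (a ∙ x) ∙ conj y (a ∙ x) ∙ y       ≡⟨ cong (λ w → (a ∙ x) ∙ (a ∙ x) ∙ w ∙ y) (sym (conj-conj y a x)) ⟩
      (a ∙ x) ∙ (a ∙ x) ∙ conj (τ y) x ∙ y         ∎

    -- χ p is the homomorphism {e , c} → {e , p} sending c to p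
    χ : Elt → Elt → Elt
    χ p k with k ≟ᶠ e
    ... | yes _ = e
    ... | no  _ = p

    χ-e : ∀ p → χ p e ≡ e
    χ-e p with e ≟ᶠ e
    ... | yes _ = refl
    ... | no e≢e = ⊥-elim (e≢e refl)

    χ-c : ∀ p → χ p c ≡ p
    χ-c p with c ≟ᶠ e
    ... | yes c≡e = ⊥-elim (c≢e c≡e)
    ... | no  _   = refl

    χ-∈ : ∀ (P : Pred) {p} → P e → P p → ∀ k → P (χ p k)
    χ-∈ P {p} Pe Pp k with k ≟ᶠ e
    ... | yes _ = Pe
    ... | no  _ = Pp

    χ-∙ : ∀ {p k k'} → p ∙ p ≡ e → C₂ k → C₂ k' → χ p (k ∙ k') ≡ χ p k ∙ χ p k'
    χ-∙ {p} {k' = k'} _ (inj₁ refl) _ =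
      trans (cong (χ p) (identityˡ k')) (sym (trans (cong (_∙ χ p k') (χ-e p)) (identityˡ _)))
    χ-∙ {p} _ (inj₂ refl) (inj₁ refl) =
      trans (cong (χ p) (identityʳ c)) (sym (trans (cong (χ p c ∙_) (χ-e p)) (identityʳ _)))
    χ-∙ {p} p²≡e (inj₂ refl) (inj₂ refl) =
      trans (cong (χ p) c²≡e) (trans (χ-e p) (sym (trans (cong₂ _∙_ (χ-c p) (χ-c p)) p²≡e)))

    module FixedCosets {x y : Elt} (x∈M : M x) (y∈M : M y) ([x,y]≡c : comm x y ≡ c)
                       (τx∈xZ : Z (x ⁻¹ ∙ τ x)) (τy∈yZ : Z (y ⁻¹ ∙ τ y)) where
      open Pair x∈M y∈M [x,y]≡c

      p q : Elt
      p = (a ∙ x) ∙ (a ∙ x)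
      q = (a ∙ y) ∙ (a ∙ y)

      p∈Ω₁Z : Ω₁Z p
      p∈Ω₁Z = square-a∙-∈Ω₁Z x∈M τx∈xZ

      q∈Ω₁Z : Ω₁Z q
      q∈Ω₁Z = square-a∙-∈Ω₁Z y∈M τy∈yZ

      F : Elt → Elt
      F m = χ p (comm m y) ∙ χ q (comm m x)

      F-values : ∀ {m i j} → (comm m y ≡ i) × (comm m x ≡ j) → F m ≡ χ p i ∙ χ q j
      F-values (refl , refl) = refl

      F-∈Ω₁Z : ∀ m → Ω₁Z (F m)
      F-∈Ω₁Z m = Ω₁Z-∙ (χ-∈ Ω₁Z Ω₁Z-e p∈Ω₁Z (comm m y)) (χ-∈ Ω₁Z Ω₁Z-e q∈Ω₁Z (comm m x))

      F-∈M : ∀ m → M (F m)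
      F-∈M m = has-∙ (χ-∈ M has-e (proj₁ (square-a∙-∈Z x∈M τx∈xZ)) (comm m y))
                     (χ-∈ M has-e (proj₁ (square-a∙-∈Z y∈M τy∈yZ)) (comm m x))

      F-trivial : ∀ {m} → (comm m y ≡ e) × (comm m x ≡ e) → F m ≡ e
      F-trivial trivial = trans (F-values trivial) (trans (cong₂ _∙_ (χ-e p) (χ-e q)) (identityˡ e))

      F-hom : ∀ {m m'} → M m → M m' → F (m ∙ m') ≡ F m ∙ F m'
      F-hom {m} {m'} m∈M m'∈M = begin
        F (m ∙ m')                                                    ≡⟨ F-values (comm-∙ˡ-M m∈M m'∈M y∈M , comm-∙ˡ-M m∈M m'∈M x∈M) ⟩
        χ p (comm m y ∙ comm m' y) ∙ χ q (comm m x ∙ comm m' x)      ≡⟨ cong₂ _∙_ (χ-∙ (proj₁ p∈Ω₁Z) (comm-∈C₂ m∈M y∈M) (comm-∈C₂ m'∈M y∈M))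
                                                                                  (χ-∙ (proj₁ q∈Ω₁Z) (comm-∈C₂ m∈M x∈M) (comm-∈C₂ m'∈M x∈M)) ⟩
        (χ p (comm m y) ∙ χ p (comm m' y)) ∙ (χ q (comm m x) ∙ χ q (comm m' x))
                                                                      ≡⟨ interchange _ _ _ _ (proj₂ (χ-∈ Ω₁Z Ω₁Z-e p∈Ω₁Z (comm m' y)) _) ⟩
        F m ∙ F m'                                                    ∎

      F-τ : ∀ {m} → M m → F (τ m) ≡ F m
      F-τ m∈M = cong₂ (λ i j → χ p i ∙ χ q j) (comm-τ-coset m∈M y∈M y∈M τy∈yZ) (comm-τ-coset m∈M x∈M x∈M τx∈xZ)

      F-c : F c ≡ e
      F-c = F-trivial (Z-values c∈Z)

      square-a∙xy : (a ∙ (x ∙ y)) ∙ (a ∙ (x ∙ y)) ≡ p ∙ q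
      square-a∙xy = begin
        (a ∙ (x ∙ y)) ∙ (a ∙ (x ∙ y))  ≡⟨ square-a∙-∙ x y ⟩
        p ∙ conj (τ y) x ∙ y           ≡⟨ cong (λ w → p ∙ w ∙ y) (conj≡∙comm (τ y) x) ⟩
        p ∙ (τ y ∙ comm (τ y) x) ∙ y   ≡⟨ cong (λ w → p ∙ (τ y ∙ w) ∙ y) (trans (comm-τ-coset y∈M x∈M x∈M τx∈xZ) [y,x]≡c) ⟩
        p ∙ (τ y ∙ c) ∙ y              ≡⟨ cong (λ w → p ∙ w ∙ y) (sym (proj₂ c∈Z (τ y) (M-τ y∈M))) ⟩
        p ∙ (c ∙ τ y) ∙ y              ≡⟨ solve monoid ⟩
        p ∙ (c ∙ τ y ∙ y)              ≡⟨ cong (p ∙_) (sym (square-a∙ y)) ⟩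
        p ∙ q                          ∎

      F≡square : ∀ {m} → M m → Z m ⊎ (F m ≡ (a ∙ m) ∙ (a ∙ m))
      F≡square m∈M with classify m∈M
      ... | inj₁ m∈Z = inj₁ m∈Z
      ... | inj₂ (inj₁ m∈xZ) = inj₂ (begin
        F _               ≡⟨ F-values (x-coset-values m∈xZ) ⟩
        χ p c ∙ χ q e     ≡⟨ cong₂ _∙_ (χ-c p) (χ-e q) ⟩
        p ∙ e             ≡⟨ identityʳ p ⟩
        p                 ≡⟨ sym (square-a∙-coset x∈M m∈xZ) ⟩
        _                 ∎)
      ... | inj₂ (inj₂ (inj₁ m∈yZ)) = inj₂ (begin
        F _               ≡⟨ F-values (y-coset-values m∈yZ) ⟩
        χ p e ∙ χ q c     ≡⟨ cong₂ _∙_ (χ-e p) (χ-c q) ⟩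
        e ∙ q             ≡⟨ identityˡ q ⟩
        q                 ≡⟨ sym (square-a∙-coset y∈M m∈yZ) ⟩
        _                 ∎)
      ... | inj₂ (inj₂ (inj₂ m∈xyZ)) = inj₂ (begin
        F _               ≡⟨ F-values (xy-coset-values m∈xyZ) ⟩
        χ p c ∙ χ q c     ≡⟨ cong₂ _∙_ (χ-c p) (χ-c q) ⟩
        p ∙ q             ≡⟨ sym square-a∙xy ⟩
        _                 ≡⟨ sym (square-a∙-coset xy∈M m∈xyZ) ⟩
        _                 ∎)

      θ : Elt → Elt
      θ g = F (μ g)

      conclusion : (∃ λ m → M m × ¬ Z m × ¬ HasOrder (a ∙ m) 2) → Conclusion
      conclusion (m₀ , m₀∈M , m₀∉Z , o[am₀]≢2) =
        conclusion-by-twist θ (F∘μ-hom F F-hom F-τ F-c) (F-∈Ω₁Z ∘ μ)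
          θ∘θ≡e (m₀ , θm₀≢e) θ-outside
        where
        θ∘θ≡e : ∀ g → θ (θ g) ≡ e
        θ∘θ≡e g = trans (cong F (μ-∈M (F-∈M (μ g)))) (F-trivial (Z-values (central∩M⊆Z (proj₂ (F-∈Ω₁Z (μ g))) (F-∈M (μ g)))))
        θm₀≢e : θ m₀ ≢ e
        θm₀≢e θm₀≡e with F≡square m₀∈M
        ... | inj₁ m₀∈Z = m₀∉Z m₀∈Z
        ... | inj₂ Fm₀≡[am₀]² = o[am₀]≢2 (square≡e⇒order2 (a∙M∌e m₀∈M)
                                  (trans (sym Fm₀≡[am₀]²) (trans (sym (cong F (μ-∈M m₀∈M))) θm₀≡e)))
        θ-outside : ∀ g → ¬ M g → (θ g ≡ e) ⊎ ((g ∙ g) ∙ θ g ≡ e)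
        θ-outside g g∉M with F≡square (∉M⇒a⁻¹∙∈M g∉M)
        ... | inj₁ m∈Z = inj₁ (trans (cong F (μ-∉M g∉M)) (F-trivial (Z-values m∈Z)))
        ... | inj₂ Fm≡[am]² = inj₂ (begin
          (g ∙ g) ∙ θ g                ≡⟨ cong₂ (λ u v → (u ∙ u) ∙ v) (sym (\\-leftDividesˡ a g)) (cong F (μ-∉M g∉M)) ⟩
          (a ∙ m) ∙ (a ∙ m) ∙ F m      ≡⟨ cong (_∙ F m) (sym Fm≡[am]²) ⟩
          F m ∙ F m                    ≡⟨ proj₁ (F-∈Ω₁Z m) ⟩
          e                            ∎)
          where m = a ⁻¹ ∙ g

    module SwappedCosets {x y : Elt} (x∈M : M x) (y∈M : M y) ([x,y]≡c : comm x y ≡ c)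
                         (τx∈yZ : Z (y ⁻¹ ∙ τ x)) where
      open Pair x∈M y∈M [x,y]≡c

      w : Elt
      w = y ⁻¹ ∙ τ x

      τx≡yw : τ x ≡ y ∙ w
      τx≡yw = sym (\\-leftDividesˡ y (τ x))

      τy≡xw : τ y ≡ x ∙ w
      τy≡xw = begin
        τ y                  ≡⟨ x≈z//y (τ y) (w ⁻¹) x (begin
          τ y ∙ w ⁻¹           ≡⟨ cong (τ y ∙_) (sym (τ-Z τx∈yZ)) ⟩
          τ y ∙ τ w            ≡⟨ sym (conj-∙ y w a) ⟩
          τ (y ∙ w)            ≡⟨ cong τ (sym τx≡yw) ⟩
          τ (τ x)              ≡⟨ τ-involutive x∈M ⟩
          x                    ∎) ⟩
        x ∙ w ⁻¹ ⁻¹          ≡⟨ cong (x ∙_) (⁻¹-involutive w) ⟩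
        x ∙ w                ∎

      τy∈xZ : Z (x ⁻¹ ∙ τ y)
      τy∈xZ = subst Z (sym (trans (cong (x ⁻¹ ∙_) τy≡xw) (\\-leftDividesʳ x w))) τx∈yZ

      F : Elt → Elt
      F m = comm m y ∙ comm m x

      F-∈C₂ : ∀ {m} → M m → C₂ (F m)
      F-∈C₂ m∈M = C₂-∙ (comm-∈C₂ m∈M y∈M) (comm-∈C₂ m∈M x∈M)

      F-hom : ∀ {m m'} → M m → M m' → F (m ∙ m') ≡ F m ∙ F m'
      F-hom m∈M m'∈M = trans (cong₂ _∙_ (comm-∙ˡ-M m∈M m'∈M y∈M) (comm-∙ˡ-M m∈M m'∈M x∈M))
                             (interchange _ _ _ _ (proj₂ (C₂⊆Ω₁Z (comm-∈C₂ m'∈M y∈M)) _))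

      F-τ : ∀ {m} → M m → F (τ m) ≡ F m
      F-τ m∈M = trans (cong₂ _∙_ (comm-τ-coset m∈M x∈M y∈M τx∈yZ) (comm-τ-coset m∈M y∈M x∈M τy∈xZ))
                      (proj₂ (C₂⊆Ω₁Z (comm-∈C₂ m∈M x∈M)) _)

      F-values : ∀ {m i j} → (comm m y ≡ i) × (comm m x ≡ j) → F m ≡ i ∙ j
      F-values (refl , refl) = refl

      F-trivial : ∀ {m} → (comm m y ≡ e) × (comm m x ≡ e) → F m ≡ e
      F-trivial trivial = trans (F-values trivial) (identityˡ e)

      square-a∙xy : (a ∙ (x ∙ y)) ∙ (a ∙ (x ∙ y)) ≡ c
      square-a∙xy = begin
        (a ∙ (x ∙ y)) ∙ (a ∙ (x ∙ y))   ≡⟨ square-a∙ (x ∙ y) ⟩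
        c ∙ τ (x ∙ y) ∙ (x ∙ y)         ≡⟨ cong (λ u → c ∙ u ∙ (x ∙ y)) (trans (conj-∙ x y a) (cong₂ _∙_ τx≡yw τy≡xw)) ⟩
        c ∙ (y ∙ w ∙ (x ∙ w)) ∙ (x ∙ y) ≡⟨ solve monoid ⟩
        c ∙ (y ∙ w ∙ (x ∙ w) ∙ x ∙ y)   ≡⟨ cong (c ∙_) cancel ⟩
        c ∙ e                           ≡⟨ identityʳ c ⟩
        c                               ∎
        where
        cancel : y ∙ w ∙ (x ∙ w) ∙ x ∙ y ≡ e
        cancel = begin
          y ∙ w ∙ (x ∙ w) ∙ x ∙ y        ≡⟨ cong (λ v → y ∙ w ∙ v ∙ x ∙ y) (sym (proj₂ τx∈yZ x x∈M)) ⟩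
          y ∙ w ∙ (w ∙ x) ∙ x ∙ y        ≡⟨ solve monoid ⟩
          y ∙ w ∙ w ∙ ((x ∙ x) ∙ y)      ≡⟨ cong (y ∙ w ∙ w ∙_) (proj₂ (square-∈Z x∈M) y y∈M) ⟩
          y ∙ w ∙ w ∙ (y ∙ (x ∙ x))      ≡⟨ solve monoid ⟩
          y ∙ w ∙ (w ∙ y) ∙ (x ∙ x)      ≡⟨ cong (λ v → y ∙ w ∙ v ∙ (x ∙ x)) (proj₂ τx∈yZ y y∈M) ⟩
          y ∙ w ∙ (y ∙ w) ∙ (x ∙ x)      ≡⟨ solve monoid ⟩
          (y ∙ w) ∙ (y ∙ w) ∙ (x ∙ x)    ≡⟨ cong (λ v → v ∙ v ∙ (x ∙ x)) (sym τx≡yw) ⟩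
          τ x ∙ τ x ∙ (x ∙ x)            ≡⟨ cong (_∙ (x ∙ x)) (sym (conj-∙ x x a)) ⟩
          τ (x ∙ x) ∙ (x ∙ x)            ≡⟨ cong (_∙ (x ∙ x)) (τ-Z (square-∈Z x∈M)) ⟩
          (x ∙ x) ⁻¹ ∙ (x ∙ x)           ≡⟨ inverseˡ _ ⟩
          e                              ∎

      F≡c-or-square≡c : ∀ {m} → M m → (F m ≡ c) ⊎ ((F m ≡ e) × ((a ∙ m) ∙ (a ∙ m) ≡ c))
      F≡c-or-square≡c m∈M with classify m∈M
      ... | inj₁ m∈Z                 = inj₂ (F-trivial (Z-values m∈Z) , square-a∙-Z m∈Z)
      ... | inj₂ (inj₁ m∈xZ)         = inj₁ (trans (F-values (x-coset-values m∈xZ)) (identityʳ c))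
      ... | inj₂ (inj₂ (inj₁ m∈yZ))  = inj₁ (trans (F-values (y-coset-values m∈yZ)) (identityˡ c))
      ... | inj₂ (inj₂ (inj₂ m∈xyZ)) = inj₂ (trans (F-values (xy-coset-values m∈xyZ)) c²≡e ,
                                             trans (square-a∙-coset xy∈M m∈xyZ) square-a∙xy)

      θ : Elt → Elt
      θ g = indicator c g ∙ F (μ g)

      θ-∈C₂ : ∀ g → C₂ (θ g)
      θ-∈C₂ g = C₂-∙ (indicator-∈ c C₂ (inj₁ refl) (inj₂ refl) g) (F-∈C₂ (M-μ g))

      θ-hom : ∀ g h → θ (g ∙ h) ≡ θ g ∙ θ h
      θ-hom g h = trans (cong₂ _∙_ (indicator-hom c c²≡e g h) (F∘μ-hom F F-hom F-τ (F-trivial (Z-values c∈Z)) g h))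
                        (interchange _ _ _ _ (proj₂ (C₂⊆Ω₁Z (indicator-∈ c C₂ (inj₁ refl) (inj₂ refl) h)) _))

      θ-∉M : ∀ {g} → ¬ M g → θ g ≡ c ∙ F (a ⁻¹ ∙ g)
      θ-∉M g∉M = cong₂ _∙_ (indicator-∉M c g∉M) (cong F (μ-∉M g∉M))

      conclusion : Conclusion
      conclusion = conclusion-by-twist θ θ-hom (C₂⊆Ω₁Z ∘ θ-∈C₂) θ∘θ≡e (a , θa≢e) θ-outside
        where
        θ∘θ≡e : ∀ g → θ (θ g) ≡ e
        θ∘θ≡e g = trans (cong₂ _∙_ (indicator-∈M c (proj₁ θg∈Z)) (trans (cong F (μ-∈M (proj₁ θg∈Z))) (F-trivial (Z-values θg∈Z))))
                        (identityˡ e)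
          where θg∈Z = C₂⊆Z (θ-∈C₂ g)
        θa≢e : θ a ≢ e
        θa≢e θa≡e = c≢e (begin
          c                ≡⟨ sym (identityʳ c) ⟩
          c ∙ e            ≡⟨ cong (c ∙_) (sym (trans (cong F (inverseˡ a)) (F-trivial (Z-values Z-subgroup.has-e)))) ⟩
          c ∙ F (a ⁻¹ ∙ a) ≡⟨ sym (θ-∉M a∉M) ⟩
          θ a              ≡⟨ θa≡e ⟩
          e                ∎)
        θ-outside : ∀ g → ¬ M g → (θ g ≡ e) ⊎ ((g ∙ g) ∙ θ g ≡ e)
        θ-outside g g∉M with F≡c-or-square≡c (∉M⇒a⁻¹∙∈M g∉M)
        ... | inj₁ Fm≡c = inj₁ (trans (θ-∉M g∉M) (trans (cong (c ∙_) Fm≡c) c²≡e))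
        ... | inj₂ (Fm≡e , [am]²≡c) = inj₂ (begin
          (g ∙ g) ∙ θ g                ≡⟨ cong₂ (λ u v → (u ∙ u) ∙ v) (sym (\\-leftDividesˡ a g)) (θ-∉M g∉M) ⟩
          (a ∙ m) ∙ (a ∙ m) ∙ (c ∙ F m) ≡⟨ cong₂ (λ u v → u ∙ (c ∙ v)) [am]²≡c Fm≡e ⟩
          c ∙ (c ∙ e)                  ≡⟨ cong (c ∙_) (identityʳ c) ⟩
          c ∙ c                        ≡⟨ c²≡e ⟩
          e                            ∎)
          where m = a ⁻¹ ∙ g

lemma3p3 : (R : FinGroup) → let open FinGroup R in
    (M : Pred) → IsSubgroup M → HasIndex M 2 → CentreIndex M 4 →
    (a : Elt) → ¬ M a → HasOrder a 4 →
    γ₂ M ≐ cyclic (a ∙ a) →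
    (∀ z → Centre M z → conj z a ≡ z ⁻¹) →
    (∃ λ m → M m × ¬ Centre M m × ¬ HasOrder (a ∙ m) 2) →
    ∃ λ (φ : Elt → Elt) → IsAutomorphism φ × (∃ λ g → φ g ≢ g) ×
      (∀ g → ¬ M g → (φ g ≡ g) ⊎ (φ g ≡ g ⁻¹))
lemma3p3 R M M-subgroup M-index M-centre-index a a∉M o[a]≡4 γ₂M≐⟨a²⟩ a-inverts-Z noninvolution =
  Sum.[ fixed , swapped ] τ-on-M/Z
  where
  open Setting R M M-subgroup M-index M-centre-index a a∉M o[a]≡4 γ₂M≐⟨a²⟩ a-inverts-Z

  fixed : FixingPair → Conclusion
  fixed (_ , _ , x∈M , y∈M , [x,y]≡c , τx∈xZ , τy∈yZ) =
    FixedCosets.conclusion x∈M y∈M [x,y]≡c τx∈xZ τy∈yZ noninvolution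

  swapped : SwappedPair → Conclusion
  swapped (_ , _ , x∈M , y∈M , [x,y]≡c , τx∈yZ) = SwappedCosets.conclusion x∈M y∈M [x,y]≡c τx∈yZ
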